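{- Let $\mathcal{A}$ be a pca with combinator $K$, and let $s,t$ be closed terms over $\mathcal{A}$. Then for every ordinal $\alpha$, $s\sim_\alpha t$ if and only if $Ks\sim_{\alpha+1}Kt$.
   Context: A pca is a set $\mathcal{A}$ with partial application $ab$ (associating to the left) containing $K,S$ with $Kab$ defined and equal to $a$, and $Sab$ defined with $Sabc\simeq ac(bc)$ for all $a,b,c\in\mathcal{A}$. Closed terms are built from elements by application; a closed term is defined iff all its subterms are defined; $s\simeq t$ means both undefined or both defined and equal. Relations $\sim_\alpha$ on closed terms: $s\sim_0 t$ iff $s\simeq t$; $s \sim_{\alpha+1} t$ iff $sx \sim_\alpha tx$ for all $x\in\mathcal{A}$; for limit $\alpha$, $s\sim_\alpha t$ iff $s\sim_\beta t$ for some $\beta<\alpha$. -}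

module Defs where

open import Data.Product using (Σ; ∃; _×_; _,_)
open import Relation.Binary.PropositionalEquality using (_≡_)

data Term (A : Set) : Set where
  el  : A → Term A
  _∙_ : Term A → Term A → Term A

infixl 7 _∙_

module Evaluation {A : Set} (_·_↓_ : A → A → A → Set) where

  data _⇓_ : Term A → A → Set where
    ⇓el  : ∀ {a} → el a ⇓ a
    ⇓app : ∀ {s t a b c} → s ⇓ a → t ⇓ b → a · b ↓ c → (s ∙ t) ⇓ c

  -- Kleene equality s ≃ t: both undefined, or both defined and equal.
  _≃_ : Term A → Term A → Set
  s ≃ t = ((∃ λ a → s ⇓ a) → ∃ λ a → (s ⇓ a) × (t ⇓ a))
        × ((∃ λ a → t ⇓ a) → ∃ λ a → (s ⇓ a) × (t ⇓ a))

-- A partial combinatory algebra. Partial application is a functional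
-- relation  a · b ↓ c  ("ab is defined and equals c").
record PCA : Set₁ where
  field
    Carrier : Set
    _·_↓_   : Carrier → Carrier → Carrier → Set
    functional : ∀ {a b c c'} → a · b ↓ c → a · b ↓ c' → c ≡ c'
    K S     : Carrier
  open Evaluation _·_↓_ public
  field
    K-ax  : ∀ a b → (el K ∙ el a ∙ el b) ⇓ a
    S-def : ∀ a b → ∃ λ v → (el S ∙ el a ∙ el b) ⇓ v
    S-ax  : ∀ a b c → (el S ∙ el a ∙ el b ∙ el c) ≃ (el a ∙ el c ∙ (el b ∙ el c))

-- Ordinals as Brouwer trees with limits of families indexed by arbitrary types.
data Ord : Set₁ where
  ozero : Ord
  osuc  : Ord → Ord
  olim  : {I : Set} → (I → Ord) → Ord

module _ (𝒜 : PCA) where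
  open PCA 𝒜

  Sim : Ord → Term Carrier → Term Carrier → Set
  Sim ozero    s t = s ≃ t
  Sim (osuc α) s t = ∀ (x : Carrier) → Sim α (s ∙ el x) (t ∙ el x)
  Sim (olim {I} f) s t = ∃ λ (i : I) → Sim (f i) s t

{-# OPTIONS --safe #-}
module Submission where

-- Ks x has exactly the values of s, for every x. All the relations ∼α only
-- look at the values of terms, so they cannot tell s from Ks x; hence Ks ∼α+1 Kt
-- says that s ∼α t holds (once for each x, and the carrier contains K).

open import Defs
open import Function.Bundles using (_⇔_; mk⇔; Equivalence)
open import Function.Properties.Equivalence using () renaming (sym to ⇔-sym)
open import Data.Product using (∃; _×_; _,_)
open import Relation.Binary.PropositionalEquality using (_≡_; refl; subst)

open Equivalence using (to; from)

module _ (𝒜 : PCA) where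
  open PCA 𝒜

  infix 4 _≈ᵛ_

  _≈ᵛ_ : Term Carrier → Term Carrier → Set
  u ≈ᵛ u' = ∀ a → u ⇓ a ⇔ u' ⇓ a

  ≈ᵛ-sym : ∀ {u u'} → u ≈ᵛ u' → u' ≈ᵛ u
  ≈ᵛ-sym e a = ⇔-sym (e a)

  ∙-congʳ : ∀ {u u'} w → u ≈ᵛ u' → u ∙ w ≈ᵛ u' ∙ w
  ∙-congʳ w e a = mk⇔ (app-transport e) (app-transport (≈ᵛ-sym e))
    where
    app-transport : ∀ {u u'} → u ≈ᵛ u' → (u ∙ w) ⇓ a → (u' ∙ w) ⇓ a
    app-transport e (⇓app p q r) = ⇓app (to (e _) p) q r

  ≃-resp-≈ᵛ : ∀ {u u' v v'} → u ≈ᵛ u' → v ≈ᵛ v' → u ≃ v → u' ≃ v'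
  ≃-resp-≈ᵛ {u} {u'} {v} {v'} eu ev (u-def , v-def) =
    (λ (a , p) → common (u-def (a , from (eu a) p))) ,
    (λ (a , p) → common (v-def (a , from (ev a) p)))
    where
    common : (∃ λ a → u ⇓ a × v ⇓ a) → ∃ λ a → u' ⇓ a × v' ⇓ a
    common (a , p , q) = a , to (eu a) p , to (ev a) q

  Sim-resp-≈ᵛ : ∀ α {u u' v v'} → u ≈ᵛ u' → v ≈ᵛ v' →
                Sim 𝒜 α u v → Sim 𝒜 α u' v'
  Sim-resp-≈ᵛ ozero    eu ev u∼v       = ≃-resp-≈ᵛ eu ev u∼v
  Sim-resp-≈ᵛ (osuc α) eu ev u∼v x     =
    Sim-resp-≈ᵛ α (∙-congʳ (el x) eu) (∙-congʳ (el x) ev) (u∼v x)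
  Sim-resp-≈ᵛ (olim f) eu ev (i , u∼v) = i , Sim-resp-≈ᵛ (f i) eu ev u∼v

  K-returns : ∀ {a x k b} → K · a ↓ k → k · x ↓ b → a ≡ b
  K-returns {a} {x} r₁ r₂ with K-ax a x
  ... | ⇓app (⇓app ⇓el ⇓el r₁′) ⇓el r₂′ with functional r₁ r₁′
  ... | refl = functional r₂′ r₂

  K∙s∙x≈ᵛs : ∀ s x → el K ∙ s ∙ el x ≈ᵛ s
  K∙s∙x≈ᵛs s x a = mk⇔ returns-s computes-s
    where
    returns-s : (el K ∙ s ∙ el x) ⇓ a → s ⇓ a
    returns-s (⇓app (⇓app ⇓el p r₁) ⇓el r₂) = subst (s ⇓_) (K-returns r₁ r₂) p

    computes-s : s ⇓ a → (el K ∙ s ∙ el x) ⇓ a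
    computes-s p with K-ax a x
    ... | ⇓app (⇓app ⇓el ⇓el r₁) ⇓el r₂ = ⇓app (⇓app ⇓el p r₁) ⇓el r₂

lemma3p3 : (𝒜 : PCA) (s t : Term (PCA.Carrier 𝒜)) (α : Ord) →
             Sim 𝒜 α s t ⇔ Sim 𝒜 (osuc α) (el (PCA.K 𝒜) ∙ s) (el (PCA.K 𝒜) ∙ t)
lemma3p3 𝒜 s t α = mk⇔
  (λ s∼t x → Sim-resp-≈ᵛ 𝒜 α (≈ᵛ-sym 𝒜 (K∙s∙x≈ᵛs 𝒜 s x))
                             (≈ᵛ-sym 𝒜 (K∙s∙x≈ᵛs 𝒜 t x)) s∼t)
  (λ Ks∼Kt → Sim-resp-≈ᵛ 𝒜 α (K∙s∙x≈ᵛs 𝒜 s K) (K∙s∙x≈ᵛs 𝒜 t K) (Ks∼Kt K))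
  where open PCA 𝒜 using (K)
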